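{- Let $\mathbb{X}=\{X_0,X_1,X_2,\dots\}$ and let $\mathscr{A}\in\mathbb{K}\langle\langle\mathbb{X}\rangle\rangle$ be the generating series $\sum_T\omega_T$ of the language of shift plethystic trees. For $n\ge 0$ define series $G^{(n)}_n,G^{(n)}_{n-1},\dots,G^{(n)}_0$ by $G^{(n)}_n=X_n$ and $G^{(n)}_j=X_j(1-G^{(n)}_{j+1})^{ -1}$ for $j=n-1,\dots,0$. Then $$\mathscr{A}=\lim_{n\to\infty}G^{(n)}_0,$$ i.e. $\mathscr{A}$ equals the noncommutative continued fraction $X_0\cfrac{1}{1-X_1\cfrac{1}{1-X_2\cfrac{1}{\ddots}}}$.
   Context: $\mathbb{K}$ is a field of characteristic zero and $\mathbb{K}\langle\langle\mathbb{X}\rangle\rangle$ the algebra of noncommutative formal power series in $\mathbb{X}$. A sequence $R_n$ converges to $R$ if for every word $\omega$, $\langle R_n,\omega\rangle=\langle R,\omega\rangle$ for all $n$ large enough. The shift $\sigma$ is the continuous algebra endomorphism with $\sigma X_i=X_{i+1}$. A shift plethystic tree is a finite plane rooted tree each of whose vertices is colored by its height (distance to the root). Its word $\omega_T$ is defined recursively: if the root has no children, $\omega_T=X_0$; if the root has subtrees $T_1,\dots,T_k$ ($k\ge1$) from left to right, $\omega_T=X_0\,\sigma\omega_{T_1}\cdots\sigma\omega_{T_k}$ (equivalently, reading the vertices in preorder and writing $X_h$ for a vertex of height $h$). -}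

module Defs where

open import Level using (Level)
open import Data.Nat using (ℕ; zero; suc; _≟_)
open import Data.List using (List; []; _∷_; map; length; concat)
open import Data.Product using (Σ; _×_; _,_)
open import Data.Fin using (Fin)
open import Relation.Nullary using (¬_; yes; no)
open import Relation.Binary.PropositionalEquality using (_≡_)
open import Function.Bundles using (_↔_)
open import Algebra.Bundles using (CommutativeRing)

module _ {c ℓ : Level} (K : CommutativeRing c ℓ) where
  open CommutativeRing K using (Carrier; _≈_; _+_; _*_; 0#; 1#)

  natK : ℕ → Carrier
  natK zero    = 0#
  natK (suc n) = 1# + natK n

  record IsFieldChar0 : Set (c Level.⊔ ℓ) where
    field
      nontrivial : ¬ (1# ≈ 0#)
      inverse    : ∀ x → ¬ (x ≈ 0#) → Σ Carrier (λ y → (x * y) ≈ 1#)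
      char0      : ∀ n → ¬ (natK (suc n) ≈ 0#)

-- Words over X = {X_0, X_1, ...}: letter X_i is represented by i.

Word : Set
Word = List ℕ

splits : Word → List (Word × Word)
splits []      = ([] , []) ∷ []
splits (a ∷ w) = ([] , a ∷ w) ∷ map (λ { (u , v) → (a ∷ u , v) }) (splits w)

module Series {c ℓ : Level} (K : CommutativeRing c ℓ) where
  open CommutativeRing K using (Carrier; _≈_; _+_; _*_; 0#; 1#)

  Ser : Set c
  Ser = Word → Carrier

  sumL : List Carrier → Carrier
  sumL []       = 0#
  sumL (x ∷ xs) = x + sumL xs

  one : Ser
  one []      = 1#
  one (_ ∷ _) = 0#

  X : ℕ → Ser
  X i (j ∷ []) with i ≟ j
  ... | yes _ = 1#
  ... | no  _ = 0#
  X i _ = 0#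

  _⊛_ : Ser → Ser → Ser
  (S ⊛ T) w = sumL (map (λ { (u , v) → S u * T v }) (splits w))

  pow : Ser → ℕ → Ser
  pow S zero    = one
  pow S (suc k) = S ⊛ pow S k

  sumUpTo : (ℕ → Carrier) → ℕ → Carrier
  sumUpTo f zero    = f zero
  sumUpTo f (suc n) = f (suc n) + sumUpTo f n

  -- (1 - S)^{-1} = Σ_k S^k, for S with zero constant term; the
  -- coefficient of a word w only receives contributions from k ≤ |w|.
  inv1- : Ser → Ser
  inv1- S w = sumUpTo (λ k → pow S k w) (length w)

  -- H m j = G^{(j+m)}_j ; so G^{(n)}_0 = H n 0 and
  -- G^{(n)}_n = X_n, G^{(n)}_j = X_j (1 - G^{(n)}_{j+1})^{-1}.
  H : ℕ → ℕ → Ser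
  H zero    j = X j
  H (suc m) j = X j ⊛ inv1- (H m (suc j))

  G : ℕ → ℕ → Ser        -- G n j = G^{(n)}_j for j ≤ n
  G n j = H (n Data.Nat.∸ j) j

-- Shift plethystic trees: plane rooted trees, vertices coloured by height.

data Tree : Set where
  node : List Tree → Tree

mutual
  wordAt : ℕ → Tree → Word
  wordAt h (node ts) = h ∷ wordsAt (suc h) ts

  wordsAt : ℕ → List Tree → Word
  wordsAt h []       = []
  wordsAt h (t ∷ ts) = wordAt h t Data.List.++ wordsAt h ts

ω : Tree → Word
ω = wordAt 0

TreesWithWord : Word → Set
TreesWithWord w = Σ Tree (λ T → ω T ≡ w)

-- 𝒜 = Σ_T ω_T : the coefficient of w is the number of trees with word w
module _ {c ℓ : Level} (K : CommutativeRing c ℓ) where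
  open CommutativeRing K using (Carrier; _≈_; _+_; _*_; 0#; 1#)
  open Series K

  IsTreeSeries : Ser → Set ℓ
  IsTreeSeries A = ∀ w → Σ ℕ (λ k → (Fin k ↔ TreesWithWord w) × (A w ≈ natK K k))

  -- R_n → R coefficientwise (stationary convergence)
  ConvergesTo : (ℕ → Ser) → Ser → Set ℓ
  ConvergesTo R L = ∀ w → Σ ℕ (λ N → ∀ n → N Data.Nat.≤ n → R n w ≈ L w)

-- The coefficient of a word w in G^{(m+h)}_h is 1 if w is the preorder word of a tree
-- whose root sits at height h, and 0 otherwise, as soon as |w| ≤ m + 1: the factor X_h accounts
-- for the root and (1 - G^{(m+h)}_{h+1})^{-1} = Σ_k (G^{(m+h)}_{h+1})^k for the sequence of subtrees,
-- a forest at height h + 1.  The sums over factorisations of w never have two nonzero terms,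
-- because forest words form a prefix code: after a forest at height h the next letter, if any, is
-- below h.  Hence ⟨G^{(n)}_0, w⟩ is constant for n ≥ |w| and equals the number (0 or 1) of trees
-- with word w; since only 0 and 1 occur, nothing about K beyond being a commutative ring is used.
module Submission where

open import Defs
open import Level using (Level)
open import Data.Product using (Σ; ∃; _×_; _,_; proj₁; proj₂)
open import Algebra.Bundles using (CommutativeRing)
open import Data.Nat as ℕ using (ℕ; zero; suc; _≤_; _<_; _≤′_; ≤′-refl; ≤′-step; z≤n; s≤s; _≟_)
open import Data.Nat.Properties using (≤-refl; m≤m+n; <-≤-trans; ≤′⇒≤; ≤⇒≤′; ≤-trans; n≤1+n; n<1+n; m≤n+m; ≤-pred; <-irrefl)
open import Data.List using (List; []; _∷_; map; length; _++_)
open import Data.List.Properties using (map-∘; ∷-injectiveˡ; ∷-injectiveʳ; ++-assoc; ++-identityʳ; length-++; ≡-dec)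
open import Data.List.Relation.Unary.All using ([]; _∷_; universal; lookup)
open import Data.List.Relation.Unary.All.Properties using () renaming (map⁺ to All-map⁺)
open import Data.List.Relation.Unary.Any using (here; there)
open import Data.List.Relation.Unary.Unique.Propositional using (Unique; []; _∷_)
open import Data.List.Relation.Unary.Unique.Propositional.Properties using () renaming (map⁺ to Unique-map⁺)
open import Data.List.Membership.Propositional using (_∈_)
open import Data.List.Membership.Propositional.Properties using (∈-map⁺; ∈-map⁻)
open import Data.Sum using (_⊎_; inj₁; inj₂)
open import Data.Empty using (⊥-elim)
open import Relation.Nullary using (¬_; yes; no)
open import Relation.Binary.PropositionalEquality using (_≡_; _≢_; refl; sym; trans; cong; cong₂; subst)
open import Data.Fin using (Fin)
open import Function.Bundles using (_↔_; mk↔ₛ′; _⇔_; mk⇔; Equivalence)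
open import Axiom.UniquenessOfIdentityProofs using (module Decidable⇒UIP)

∈-splits⁻ : ∀ w {u v} → (u , v) ∈ splits w → u ++ v ≡ w
∈-splits⁻ []      (here refl) = refl
∈-splits⁻ (a ∷ w) (here refl) = refl
∈-splits⁻ (a ∷ w) (there p) with ∈-map⁻ _ p
... | (_ , q , refl) = cong (a ∷_) (∈-splits⁻ w q)

∈-splits⁺ : ∀ u v → (u , v) ∈ splits (u ++ v)
∈-splits⁺ []      []      = here refl
∈-splits⁺ []      (b ∷ v) = here refl
∈-splits⁺ (a ∷ u) v       = there (∈-map⁺ _ (∈-splits⁺ u v))

splits-unique : ∀ w → Unique (splits w)
splits-unique []      = [] ∷ []
splits-unique (a ∷ w) =
  All-map⁺ (universal (λ _ ()) (splits w)) ∷ Unique-map⁺ consˡ-injective (splits-unique w)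
  where
  consˡ-injective : ∀ {p q : Word × Word} → (a ∷ proj₁ p , proj₂ p) ≡ (a ∷ proj₁ q , proj₂ q) → p ≡ q
  consˡ-injective refl = refl

∈-splits-length : ∀ w {u v} → (u , v) ∈ splits w → length u ℕ.+ length v ≡ length w
∈-splits-length w {u} m = trans (sym (length-++ u)) (cong length (∈-splits⁻ w m))

∈-splits-suffix-≤ : ∀ w {u v} → (u , v) ∈ splits w → length v ≤ length w
∈-splits-suffix-≤ w {u} {v} m = subst (length v ≤_) (∈-splits-length w m) (m≤n+m (length v) (length u))

∈-splits-prefix-≤ : ∀ w {u v} → (u , v) ∈ splits w → length u ≤ length w
∈-splits-prefix-≤ w {u} {v} m = subst (length u ≤_) (∈-splits-length w m) (m≤m+n (length u) (length v))

∈-splits-proper-suffix-< : ∀ w {b u v} → (b ∷ u , v) ∈ splits w → length v < length w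
∈-splits-proper-suffix-< w {u = u} {v} m =
  subst (length v <_) (∈-splits-length w m) (s≤s (m≤n+m (length v) (length u)))

TreesWithWordAt : ℕ → Word → Set
TreesWithWordAt h w = Σ Tree (λ t → wordAt h t ≡ w)

ForestsWithWordAt : ℕ → Word → Set
ForestsWithWordAt h w = Σ (List Tree) (λ ts → wordsAt h ts ≡ w)

data StartsBelow (h : ℕ) : Word → Set where
  []  : StartsBelow h []
  _∷_ : ∀ {b} → b < h → ∀ r → StartsBelow h (b ∷ r)

startsBelow-suc : ∀ h ts {r} → StartsBelow h r → StartsBelow (suc h) (wordsAt h ts ++ r)
startsBelow-suc h []           []        = []
startsBelow-suc h []           (b<h ∷ r) = ≤-trans b<h (n≤1+n h) ∷ r
startsBelow-suc h (node _ ∷ _) _         = n<1+n h ∷ _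

startsBelow-≢ : ∀ {h r s} → StartsBelow h r → r ≢ h ∷ s
startsBelow-≢ (h<h ∷ _) refl = <-irrefl refl h<h

wordsAt-++-injective : ∀ h ts ts' {r r'} → StartsBelow h r → StartsBelow h r' →
  wordsAt h ts ++ r ≡ wordsAt h ts' ++ r' → ts ≡ ts' × r ≡ r'
wordsAt-++-injective h []              []                _  _   e = refl , e
wordsAt-++-injective h []              (node _ ∷ _)      br _   e = ⊥-elim (startsBelow-≢ br e)
wordsAt-++-injective h (node _ ∷ _)    []                _  br' e = ⊥-elim (startsBelow-≢ br' (sym e))
wordsAt-++-injective h (node cs ∷ ts) (node cs' ∷ ts') {r} {r'} br br' e
  with wordsAt-++-injective (suc h) cs cs' (startsBelow-suc h ts br) (startsBelow-suc h ts' br')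
         (trans (sym (++-assoc (wordsAt (suc h) cs) (wordsAt h ts) r))
           (trans (∷-injectiveʳ e) (++-assoc (wordsAt (suc h) cs') (wordsAt h ts') r')))
... | refl , e′ with wordsAt-++-injective h ts ts' br br' e′
... | refl , refl = refl , refl

wordsAt-injective : ∀ h {ts ts'} → wordsAt h ts ≡ wordsAt h ts' → ts ≡ ts'
wordsAt-injective h {ts} {ts'} e = proj₁ (wordsAt-++-injective h ts ts' [] []
  (trans (++-identityʳ (wordsAt h ts)) (trans e (sym (++-identityʳ (wordsAt h ts'))))))

wordAt-injective : ∀ h {t t'} → wordAt h t ≡ wordAt h t' → t ≡ t'
wordAt-injective h {node cs} {node cs'} e = cong node (wordsAt-injective (suc h) (∷-injectiveʳ e))

treesWithWordAt-irrelevant : ∀ h w (p q : TreesWithWordAt h w) → p ≡ q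
treesWithWordAt-irrelevant h w (t , e) (t' , e') with wordAt-injective h (trans e (sym e'))
... | refl = cong (t ,_) (Decidable⇒UIP.≡-irrelevant (≡-dec _≟_) e e')

treesWithWordAt-∷ : ∀ h a w → (h ≡ a × ForestsWithWordAt (suc h) w) ⇔ TreesWithWordAt h (a ∷ w)
treesWithWordAt-∷ h a w = mk⇔
  (λ { (refl , ts , e) → node ts , cong (h ∷_) e })
  (λ { (node ts , e) → ∷-injectiveˡ e , ts , ∷-injectiveʳ e })

TreeThenForest : ℕ → ℕ → Word × Word → Set
TreeThenForest h a (u , v) = TreesWithWordAt h (a ∷ u) × ForestsWithWordAt h v

forestsWithWordAt-∷ : ∀ h a w →
  ∃ (λ p → p ∈ splits w × TreeThenForest h a p) ⇔ ForestsWithWordAt h (a ∷ w)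
forestsWithWordAt-∷ h a w = mk⇔ join split
  where
  split : ForestsWithWordAt h (a ∷ w) → ∃ (λ p → p ∈ splits w × TreeThenForest h a p)
  split (node cs ∷ ts , e) =
    (wordsAt (suc h) cs , wordsAt h ts) ,
    subst (λ w′ → (wordsAt (suc h) cs , wordsAt h ts) ∈ splits w′) (∷-injectiveʳ e) (∈-splits⁺ _ _) ,
    (node cs , cong (_∷ wordsAt (suc h) cs) (∷-injectiveˡ e)) , (ts , refl)
  join : ∃ (λ p → p ∈ splits w × TreeThenForest h a p) → ForestsWithWordAt h (a ∷ w)
  join ((u , v) , m , (t , et) , (ts , ets)) = t ∷ ts , trans (cong₂ _++_ et ets) (cong (a ∷_) (∈-splits⁻ w m))

treeThenForest-unique : ∀ h a w {p q} → p ∈ splits w → q ∈ splits w →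
  TreeThenForest h a p → TreeThenForest h a q → p ≡ q
treeThenForest-unique h a w {u , v} {u' , v'} m m' ((t , et) , (ts , ets)) ((t' , et') , (ts' , ets'))
  with wordsAt-injective h {t ∷ ts} {t' ∷ ts'}
         (trans (cong₂ _++_ et ets) (trans (cong (a ∷_) (trans (∈-splits⁻ w m) (sym (∈-splits⁻ w m'))))
           (sym (cong₂ _++_ et' ets'))))
... | refl = cong₂ _,_ (∷-injectiveʳ (trans (sym et) et')) (trans (sym ets) ets')

module CoefficientsOver {c ℓ : Level} (K : CommutativeRing c ℓ) where
  open CommutativeRing K hiding (zero) renaming (refl to ≈-refl; sym to ≈-sym; trans to ≈-trans)
  open Series K
  open import Algebra.Properties.CommutativeSemigroup +-commutativeSemigroup using (interchange)
  open import Relation.Binary.Reasoning.Setoid setoid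

  ∂ : ℕ → Ser → Ser
  ∂ a S u = S (a ∷ u)

  sumL-cong : {A : Set} {f g : A → Carrier} (xs : List A) →
    (∀ x → x ∈ xs → f x ≈ g x) → sumL (map f xs) ≈ sumL (map g xs)
  sumL-cong []       f≈g = ≈-refl
  sumL-cong (x ∷ xs) f≈g = +-cong (f≈g x (here refl)) (sumL-cong xs (λ y m → f≈g y (there m)))

  sumL-zero : {A : Set} {f : A → Carrier} (xs : List A) → (∀ x → x ∈ xs → f x ≈ 0#) → sumL (map f xs) ≈ 0#
  sumL-zero []       f≈0 = ≈-refl
  sumL-zero (x ∷ xs) f≈0 =
    ≈-trans (+-cong (f≈0 x (here refl)) (sumL-zero xs (λ y m → f≈0 y (there m)))) (+-identityˡ 0#)

  sumL-+ : {A : Set} (f g : A → Carrier) (xs : List A) →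
    sumL (map (λ x → f x + g x) xs) ≈ sumL (map f xs) + sumL (map g xs)
  sumL-+ f g []       = ≈-sym (+-identityˡ 0#)
  sumL-+ f g (x ∷ xs) = ≈-trans (+-cong ≈-refl (sumL-+ f g xs)) (interchange (f x) (g x) _ _)

  ⊛-∷ : ∀ S T a w → (S ⊛ T) (a ∷ w) ≡ S [] * T (a ∷ w) + (∂ a S ⊛ T) w
  ⊛-∷ S T a w = cong (λ xs → S [] * T (a ∷ w) + sumL xs) (sym (map-∘ (splits w)))

  ⊛-congʳ : ∀ S {T T'} w → (∀ {u v} → (u , v) ∈ splits w → T v ≈ T' v) → (S ⊛ T) w ≈ (S ⊛ T') w
  ⊛-congʳ S w T≈T' = sumL-cong (splits w) (λ { (u , v) m → *-cong ≈-refl (T≈T' m) })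

  ⊛-distribˡ : ∀ S T T' w → (S ⊛ (λ v → T v + T' v)) w ≈ (S ⊛ T) w + (S ⊛ T') w
  ⊛-distribˡ S T T' w = ≈-trans
    (sumL-cong (splits w) (λ { (u , v) _ → distribˡ (S u) (T v) (T' v) }))
    (sumL-+ (λ p → S (proj₁ p) * T (proj₂ p)) (λ p → S (proj₁ p) * T' (proj₂ p)) (splits w))

  ⊛-zeroˡ : ∀ {S} T → (∀ u → S u ≈ 0#) → ∀ w → (S ⊛ T) w ≈ 0#
  ⊛-zeroˡ T S≈0 w =
    sumL-zero (splits w) (λ { (u , v) _ → ≈-trans (*-cong (S≈0 u) ≈-refl) (zeroˡ (T v)) })

  ⊛-constantˡ : ∀ {S} T → (∀ b u → S (b ∷ u) ≈ 0#) → ∀ w → (S ⊛ T) w ≈ S [] * T w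
  ⊛-constantˡ {S} T S≈0 []      = +-identityʳ (S [] * T [])
  ⊛-constantˡ {S} T S≈0 (b ∷ w) = begin
    (S ⊛ T) (b ∷ w)                      ≡⟨ ⊛-∷ S T b w ⟩
    S [] * T (b ∷ w) + (∂ b S ⊛ T) w     ≈⟨ +-cong ≈-refl (⊛-zeroˡ T (S≈0 b) w) ⟩
    S [] * T (b ∷ w) + 0#                ≈⟨ +-identityʳ _ ⟩
    S [] * T (b ∷ w)                     ∎

  sumUpTo-cong : ∀ {f g} → (∀ k → f k ≈ g k) → ∀ n → sumUpTo f n ≈ sumUpTo g n
  sumUpTo-cong f≈g zero    = f≈g zero
  sumUpTo-cong f≈g (suc n) = +-cong (f≈g (suc n)) (sumUpTo-cong f≈g n)

  sumUpTo-suc : ∀ f n → sumUpTo f (suc n) ≈ sumUpTo (λ k → f (suc k)) n + f zero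
  sumUpTo-suc f zero    = ≈-refl
  sumUpTo-suc f (suc n) = ≈-trans (+-cong ≈-refl (sumUpTo-suc f n)) (≈-sym (+-assoc _ _ _))

  sumUpTo-vanishing : ∀ {f n m} → (∀ k → n < k → f k ≈ 0#) → n ≤′ m → sumUpTo f m ≈ sumUpTo f n
  sumUpTo-vanishing f≈0 ≤′-refl      = ≈-refl
  sumUpTo-vanishing f≈0 (≤′-step n≤m) =
    ≈-trans (+-cong (f≈0 _ (s≤s (≤′⇒≤ n≤m))) (sumUpTo-vanishing f≈0 n≤m)) (+-identityˡ _)

  ⊛-sumUpToʳ : ∀ S (T : ℕ → Ser) w n →
    (S ⊛ (λ v → sumUpTo (λ k → T k v) n)) w ≈ sumUpTo (λ k → (S ⊛ T k) w) n
  ⊛-sumUpToʳ S T w zero    = ≈-refl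
  ⊛-sumUpToʳ S T w (suc n) =
    ≈-trans (⊛-distribˡ S (T (suc n)) _ w) (+-cong ≈-refl (⊛-sumUpToʳ S T w n))

  pow-vanishes : ∀ {S} → S [] ≈ 0# → ∀ k w → length w < k → pow S k w ≈ 0#
  pow-vanishes {S} S[]≈0 (suc k) w |w|<1+k = sumL-zero (splits w) term
    where
    term : ∀ p → p ∈ splits w → S (proj₁ p) * pow S k (proj₂ p) ≈ 0#
    term ([] , v)    _ = ≈-trans (*-cong S[]≈0 ≈-refl) (zeroˡ _)
    term (b ∷ u , v) m = ≈-trans (*-cong ≈-refl (pow-vanishes S[]≈0 k v |v|<k)) (zeroʳ _)
      where
      |v|<k : length v < k
      |v|<k = <-≤-trans (∈-splits-proper-suffix-< w m) (≤-pred |w|<1+k)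

  inv1-∷ : ∀ {S} → S [] ≈ 0# → ∀ a w → inv1- S (a ∷ w) ≈ (∂ a S ⊛ inv1- S) w
  inv1-∷ {S} S[]≈0 a w = begin
    inv1- S (a ∷ w)                                              ≈⟨ sumUpTo-suc _ (length w) ⟩
    sumUpTo (λ k → pow S (suc k) (a ∷ w)) (length w) + 0#        ≈⟨ +-identityʳ _ ⟩
    sumUpTo (λ k → pow S (suc k) (a ∷ w)) (length w)             ≈⟨ sumUpTo-cong pow-suc-∷ (length w) ⟩
    sumUpTo (λ k → (∂ a S ⊛ pow S k) w) (length w)               ≈⟨ ⊛-sumUpToʳ (∂ a S) (pow S) w (length w) ⟨
    (∂ a S ⊛ (λ v → sumUpTo (λ k → pow S k v) (length w))) w    ≈⟨ ⊛-congʳ (∂ a S) w truncate ⟩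
    (∂ a S ⊛ inv1- S) w                                          ∎
    where
    pow-suc-∷ : ∀ k → pow S (suc k) (a ∷ w) ≈ (∂ a S ⊛ pow S k) w
    pow-suc-∷ k = begin
      pow S (suc k) (a ∷ w)                                ≡⟨ ⊛-∷ S (pow S k) a w ⟩
      S [] * pow S k (a ∷ w) + (∂ a S ⊛ pow S k) w        ≈⟨ +-cong (≈-trans (*-cong S[]≈0 ≈-refl) (zeroˡ _)) ≈-refl ⟩
      0# + (∂ a S ⊛ pow S k) w                            ≈⟨ +-identityˡ _ ⟩
      (∂ a S ⊛ pow S k) w                                 ∎
    truncate : ∀ {u v} → (u , v) ∈ splits w → sumUpTo (λ k → pow S k v) (length w) ≈ inv1- S v
    truncate {v = v} m =
      sumUpTo-vanishing (λ k → pow-vanishes S[]≈0 k v) (≤⇒≤′ (∈-splits-suffix-≤ w m))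

  Indicates : Carrier → Set → Set ℓ
  Indicates x A = (x ≈ 1# × A) ⊎ (x ≈ 0# × ¬ A)

  Indicates-resp : ∀ {x y A} → x ≈ y → Indicates y A → Indicates x A
  Indicates-resp x≈y (inj₁ (y≈1 , a))  = inj₁ (≈-trans x≈y y≈1 , a)
  Indicates-resp x≈y (inj₂ (y≈0 , ¬a)) = inj₂ (≈-trans x≈y y≈0 , ¬a)

  Indicates-⇔ : ∀ {x A B} → A ⇔ B → Indicates x A → Indicates x B
  Indicates-⇔ A⇔B (inj₁ (x≈1 , a))  = inj₁ (x≈1 , Equivalence.to A⇔B a)
  Indicates-⇔ A⇔B (inj₂ (x≈0 , ¬a)) = inj₂ (x≈0 , λ b → ¬a (Equivalence.from A⇔B b))

  Indicates-unique : ∀ {x y A} → Indicates x A → Indicates y A → x ≈ y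
  Indicates-unique (inj₁ (x≈1 , _))  (inj₁ (y≈1 , _))  = ≈-trans x≈1 (≈-sym y≈1)
  Indicates-unique (inj₁ (_ , a))    (inj₂ (_ , ¬a))   = ⊥-elim (¬a a)
  Indicates-unique (inj₂ (_ , ¬a))   (inj₁ (_ , a))    = ⊥-elim (¬a a)
  Indicates-unique (inj₂ (x≈0 , _))  (inj₂ (y≈0 , _))  = ≈-trans x≈0 (≈-sym y≈0)

  Indicates-* : ∀ {x y A B} → Indicates x A → Indicates y B → Indicates (x * y) (A × B)
  Indicates-* (inj₁ (x≈1 , a)) (inj₁ (y≈1 , b)) =
    inj₁ (≈-trans (*-cong x≈1 y≈1) (*-identityˡ 1#) , a , b)
  Indicates-* (inj₁ (x≈1 , a)) (inj₂ (y≈0 , ¬b)) =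
    inj₂ (≈-trans (*-cong ≈-refl y≈0) (zeroʳ _) , λ ab → ¬b (proj₂ ab))
  Indicates-* (inj₂ (x≈0 , ¬a)) _ =
    inj₂ (≈-trans (*-cong x≈0 ≈-refl) (zeroˡ _) , λ ab → ¬a (proj₁ ab))

  Indicates-sumL : {A : Set} {f : A → Carrier} {Q : A → Set} (xs : List A) → Unique xs →
    (∀ p → p ∈ xs → Indicates (f p) (Q p)) →
    (∀ {p q} → p ∈ xs → q ∈ xs → Q p → Q q → p ≡ q) →
    Indicates (sumL (map f xs)) (∃ λ p → p ∈ xs × Q p)
  Indicates-sumL [] _ _ _ = inj₂ (≈-refl , λ { (_ , () , _) })
  Indicates-sumL {Q = Q} (x ∷ xs) (x∉xs ∷ unique) ind Q-unique
    with ind x (here refl)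
       | Indicates-sumL xs unique (λ p m → ind p (there m)) (λ m m' → Q-unique (there m) (there m'))
  ... | inj₁ (_ , Qx)   | inj₁ (_ , y , m , Qy) =
    ⊥-elim (lookup x∉xs m (Q-unique (here refl) (there m) Qx Qy))
  ... | inj₁ (fx≈1 , Qx) | inj₂ (Σ≈0 , _)       =
    inj₁ (≈-trans (+-cong fx≈1 Σ≈0) (+-identityʳ 1#) , x , here refl , Qx)
  ... | inj₂ (fx≈0 , _)  | inj₁ (Σ≈1 , y , m , Qy) =
    inj₁ (≈-trans (+-cong fx≈0 Σ≈1) (+-identityˡ 1#) , y , there m , Qy)
  ... | inj₂ (fx≈0 , ¬Qx) | inj₂ (Σ≈0 , ¬∃)     =
    inj₂ (≈-trans (+-cong fx≈0 Σ≈0) (+-identityˡ 0#) ,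
          λ { (_ , here refl , Qx) → ¬Qx Qx ; (y , there m , Qy) → ¬∃ (y , m , Qy) })

  Indicates-X : ∀ i j → Indicates (X i (j ∷ [])) (i ≡ j)
  Indicates-X i j with i ≟ j
  ... | yes i≡j = inj₁ (≈-refl , i≡j)
  ... | no  i≢j = inj₂ (≈-refl , i≢j)

  Indicates-count : ∀ {x A} → Indicates x A → (∀ (p q : A) → p ≡ q) →
    Σ ℕ (λ k → (Fin k ↔ A) × x ≈ natK K k)
  Indicates-count (inj₁ (x≈1 , a)) irrelevant =
    1 , mk↔ₛ′ (λ _ → a) (λ _ → Fin.zero) (irrelevant a) (λ { Fin.zero → refl ; (Fin.suc ()) }) ,
    ≈-trans x≈1 (≈-sym (+-identityʳ 1#))
  Indicates-count (inj₂ (x≈0 , ¬a)) _ =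
    0 , mk↔ₛ′ (λ ()) (λ a → ⊥-elim (¬a a)) (λ a → ⊥-elim (¬a a)) (λ ()) , x≈0

  X⊛-∷ : ∀ i T a w → (X i ⊛ T) (a ∷ w) ≈ X i (a ∷ []) * T w
  X⊛-∷ i T a w = begin
    (X i ⊛ T) (a ∷ w)                                ≡⟨ ⊛-∷ (X i) T a w ⟩
    0# * T (a ∷ w) + (∂ a (X i) ⊛ T) w              ≈⟨ +-cong (zeroˡ _) (⊛-constantˡ T (λ _ _ → ≈-refl) w) ⟩
    0# + X i (a ∷ []) * T w                          ≈⟨ +-identityˡ _ ⟩
    X i (a ∷ []) * T w                               ∎

  inv1-indicates-forests : ∀ h S B → (∀ u → length u ≤ B → Indicates (S u) (TreesWithWordAt h u)) →
    ∀ w → length w ≤ B → Indicates (inv1- S w) (ForestsWithWordAt h w)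
  inv1-indicates-forests h S B       trees []      _         = inj₁ (≈-refl , [] , refl)
  inv1-indicates-forests h S (suc B) trees (a ∷ w) (s≤s |w|≤B) =
    Indicates-resp (inv1-∷ S[]≈0 a w)
      (Indicates-⇔ (forestsWithWordAt-∷ h a w)
        (Indicates-sumL (splits w) (splits-unique w) tree-then-forest (treeThenForest-unique h a w)))
    where
    S[]≈0 : S [] ≈ 0#
    S[]≈0 = Indicates-unique (trees [] z≤n) (inj₂ (≈-refl , λ { (node _ , ()) }))
    tree-then-forest : ∀ p → p ∈ splits w →
      Indicates (S (a ∷ proj₁ p) * inv1- S (proj₂ p)) (TreeThenForest h a p)
    tree-then-forest (u , v) m = Indicates-*
      (trees (a ∷ u) (s≤s (≤-trans (∈-splits-prefix-≤ w m) |w|≤B)))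
      (inv1-indicates-forests h S B (λ u′ |u′|≤B → trees u′ (≤-trans |u′|≤B (n≤1+n B))) v
        (≤-trans (∈-splits-suffix-≤ w m) |w|≤B))

  H-[] : ∀ m h → H m h [] ≈ 0#
  H-[] zero    h = ≈-refl
  H-[] (suc m) h = ≈-trans (+-identityʳ _) (zeroˡ _)

  H-indicates-trees : ∀ m h u → length u ≤ suc m → Indicates (H m h u) (TreesWithWordAt h u)
  H-indicates-trees m       h []          _ = inj₂ (H-[] m h , λ { (node _ , ()) })
  H-indicates-trees zero    h (a ∷ [])    _ =
    Indicates-⇔ (mk⇔ (λ { refl → node [] , refl }) (λ { (node _ , e) → ∷-injectiveˡ e })) (Indicates-X h a)
  H-indicates-trees zero    h (_ ∷ _ ∷ _) (s≤s ())
  H-indicates-trees (suc m) h (a ∷ w) (s≤s |w|≤1+m) =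
    Indicates-resp (X⊛-∷ h (inv1- (H m (suc h))) a w)
      (Indicates-⇔ (treesWithWordAt-∷ h a w)
        (Indicates-* (Indicates-X h a)
          (inv1-indicates-forests (suc h) (H m (suc h)) (suc m) (H-indicates-trees m (suc h)) w |w|≤1+m)))

mainTheorem3 : {c ℓ : Level} (K : CommutativeRing c ℓ) → IsFieldChar0 K →
    Σ (Series.Ser K) (λ 𝒜 → IsTreeSeries K 𝒜 × ConvergesTo K (λ n → Series.G K n 0) 𝒜)
mainTheorem3 K _ = 𝒜 , isTreeSeries , converges
  where
  open CoefficientsOver K
  𝒜 : Series.Ser K
  𝒜 w = Series.G K (length w) 0 w
  G-indicates-trees : ∀ n w → length w ≤ n → Indicates (Series.G K n 0 w) (TreesWithWord w)
  G-indicates-trees n w |w|≤n = H-indicates-trees n 0 w (≤-trans |w|≤n (n≤1+n n))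
  isTreeSeries : IsTreeSeries K 𝒜
  isTreeSeries w = Indicates-count (G-indicates-trees (length w) w ≤-refl) (treesWithWordAt-irrelevant 0 w)
  converges : ConvergesTo K (λ n → Series.G K n 0) 𝒜
  converges w = length w , λ n |w|≤n →
    Indicates-unique (G-indicates-trees n w |w|≤n) (G-indicates-trees (length w) w ≤-refl)
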